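{- Let $p$ be a prime. For every integer $n\ge0$, the polynomial $\frac{x_{(n+1)}}{x}=(x-1)(x-2)\cdots(x-n)$ satisfies $$\int_{\mathbb{Z}_p}\frac{x_{(n+1)}}{x}\,d\mu_1(x)=(-1)^n\sum_{k=0}^{n}n_{(n-k)}\frac{k!}{k+1}.$$
   Context: The Volkenborn integral of a polynomial function $f:\mathbb{Z}_p\to\mathbb{Q}_p$ is $\int_{\mathbb{Z}_p}f(x)\,d\mu_1(x)=\lim_{N\to\infty}p^{ -N}\sum_{x=0}^{p^N-1}f(x)$. The falling factorial is $x_{(n)}=x(x-1)\cdots(x-n+1)$, $x_{(0)}=1$; in particular $n_{(n-k)}=n!/k!$. -}

module Defs where

open import Data.Nat as ℕ using (ℕ; zero; suc; _≤_; _^_; NonZero)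
open import Data.Nat.Properties using (m^n≢0)
open import Data.Nat.Divisibility using (_∣_)
open import Data.Nat.Primality using (Prime; prime⇒nonZero)

open import Data.Integer as ℤ using (ℤ; +_)
open import Data.Rational using (ℚ; _+_; _*_; _-_; -_; _/_; 0ℚ; 1ℚ; ↥_; ↧ₙ_)
open import Data.Product using (Σ; _×_)
open import Relation.Nullary using (¬_)

ι : ℕ → ℚ
ι n = (+ n) / 1

sumBelow : ℕ → (ℕ → ℚ) → ℚ
sumBelow zero    f = 0ℚ
sumBelow (suc m) f = sumBelow m f + f m

falling : ℚ → ℕ → ℚ
falling x zero    = 1ℚ
falling x (suc m) = falling x m * (x - ι m)

fallingDivX : ℕ → ℚ → ℚ
fallingDivX zero    x = 1ℚ
fallingDivX (suc n) x = fallingDivX n x * (x - ι (suc n))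

signPow : ℕ → ℚ
signPow zero    = 1ℚ
signPow (suc n) = - signPow n

-- p-adic smallness: v_p(q) ≥ k, for q ∈ ℚ and k ∈ ℕ
-- (numerator divisible by p^k and denominator prime to p; q = 0 satisfies it for all k)
pAdicValGE : ℕ → ℚ → ℕ → Set
pAdicValGE p q k = ((p ^ k) ∣ ℤ.∣ ↥ q ∣) × ¬ (p ∣ ↧ₙ q)

PAdicLimit : ℕ → (ℕ → ℚ) → ℚ → Set
PAdicLimit p a L = (k : ℕ) → Σ ℕ λ N₀ → (N : ℕ) → N₀ ≤ N → pAdicValGE p (a N - L) k

volkenbornSum : (p : ℕ) → Prime p → (ℕ → ℚ) → ℕ → ℚ
volkenbornSum p pp f N =
  _/_ (+ 1) (p ^ N) {{m^n≢0 p N {{prime⇒nonZero pp}}}} * sumBelow (p ^ N) (λ x → f x)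

-- "∫_{ℤ_p} f dμ₁ = L" : the Volkenborn limit exists in ℚ_p and equals L
VolkenbornIntegralIs : (p : ℕ) → Prime p → (ℚ → ℚ) → ℚ → Set
VolkenbornIntegralIs p pp f L = PAdicLimit p (volkenbornSum p pp (λ x → f (ι x))) L

rhs7 : ℕ → ℚ
rhs7 n = signPow n * sumBelow (suc n) (λ k → falling (ι n) (n ℕ.∸ k) * ((+ (k ℕ.!)) / suc k))

-- Write f(x) = (x−1)(x−2)⋯(x−n) = (x−1)₍ₙ₎. Since (y+1)₍ₙ₊₁₎ − y₍ₙ₊₁₎ = (n+1)·y₍ₙ₎, the Riemann
-- sums telescope: (n+1)·Σ_{x<M} f(x) = (M−1)₍ₙ₊₁₎ − (−1)₍ₙ₊₁₎. Expanding (−1+M)₍ₙ₊₁₎ to second order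
-- in M gives (−1)₍ₙ₊₁₎ + M·D + M²·R with D and R integers, and D, the derivative of x₍ₙ₊₁₎ at −1, is
-- (−1)ⁿ (n+1)! H_{n+1} = (n+1)·RHS. Hence M⁻¹ Σ_{x<M} f(x) − RHS = M·R/(n+1), and for M = pᴺ this has
-- p-adic valuation at least N − v_p(n+1) ≥ N − n.
{-# OPTIONS --safe #-}
module Submission where

open import Defs

open import Data.Integer as ℤ using (ℤ; +_)
import Data.Integer.Properties as ℤ
import Data.Integer.Tactic.RingSolver as ℤ-Solver
open import Data.Nat as ℕ using (ℕ; zero; suc; _!; _^_; _≤_; _<_; z≤n; s≤s; NonZero)
import Data.Nat.Properties as ℕ
import Data.Nat.Tactic.RingSolver as ℕ-Solver
open import Data.Nat.Divisibility using (_∣_; _∣?_; divides; ∣-trans; m∣m*n; 1∣_; *-monoʳ-∣; *-cancelˡ-∣)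
open import Data.Nat.Induction using (<-rec)
open import Data.Nat.Primality using (Prime; prime⇒nonZero; prime⇒nonTrivial; euclidsLemma)
open import Data.Product using (Σ-syntax; ∃-syntax; _×_; _,_)
open import Data.Rational using (ℚ; _+_; _*_; _-_; -_; _/_; 0ℚ; 1ℚ; ↥_; ↧_; ↧ₙ_; fromℚᵘ)
open import Data.Rational.Properties
  using (+-identityʳ; +-assoc; +-inverseʳ; *-comm; *-assoc; *-identityˡ; *-identityʳ; *-zeroʳ; *-distribˡ-+; ↥-/; ↧-/;
         fromℚᵘ-cong; fromℚᵘ-toℚᵘ; toℚᵘ-fromℚᵘ; toℚᵘ-homo-+; toℚᵘ-homo-*; toℚᵘ-homo‿-)
open import Data.Rational.Unnormalised as ℚᵘ using (ℚᵘ; mkℚᵘ; *≡*)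
import Data.Rational.Unnormalised.Properties as ℚᵘ
open import Data.Integer.GCD using (gcd)
open import Data.Sum using (inj₁; inj₂)
open import Relation.Binary.PropositionalEquality
open import Relation.Nullary using (¬_; yes; no; contradiction)
open import Data.Rational.Solver using (module +-*-Solver)

open ≡-Reasoning
open +-*-Solver

-- Integers inside ℚ

fromℤ : ℤ → ℚ
fromℤ z = z / 1

fromℚᵘ-homo-+ : ∀ x y → fromℚᵘ (x ℚᵘ.+ y) ≡ fromℚᵘ x + fromℚᵘ y
fromℚᵘ-homo-+ x y = trans
  (fromℚᵘ-cong (ℚᵘ.≃-trans (ℚᵘ.+-cong (ℚᵘ.≃-sym (toℚᵘ-fromℚᵘ x)) (ℚᵘ.≃-sym (toℚᵘ-fromℚᵘ y)))
                           (ℚᵘ.≃-sym (toℚᵘ-homo-+ (fromℚᵘ x) (fromℚᵘ y)))))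
  (fromℚᵘ-toℚᵘ _)

fromℚᵘ-homo-* : ∀ x y → fromℚᵘ (x ℚᵘ.* y) ≡ fromℚᵘ x * fromℚᵘ y
fromℚᵘ-homo-* x y = trans
  (fromℚᵘ-cong (ℚᵘ.≃-trans (ℚᵘ.*-cong (ℚᵘ.≃-sym (toℚᵘ-fromℚᵘ x)) (ℚᵘ.≃-sym (toℚᵘ-fromℚᵘ y)))
                           (ℚᵘ.≃-sym (toℚᵘ-homo-* (fromℚᵘ x) (fromℚᵘ y)))))
  (fromℚᵘ-toℚᵘ _)

fromℚᵘ-homo‿- : ∀ x → fromℚᵘ (ℚᵘ.- x) ≡ - fromℚᵘ x
fromℚᵘ-homo‿- x = trans
  (fromℚᵘ-cong (ℚᵘ.≃-trans (ℚᵘ.-‿cong (ℚᵘ.≃-sym (toℚᵘ-fromℚᵘ x)))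
                           (ℚᵘ.≃-sym (toℚᵘ-homo‿- (fromℚᵘ x)))))
  (fromℚᵘ-toℚᵘ _)

fromℤ-+ : ∀ a b → fromℤ (a ℤ.+ b) ≡ fromℤ a + fromℤ b
fromℤ-+ a b = trans (fromℚᵘ-cong {mkℚᵘ (a ℤ.+ b) 0} {mkℚᵘ a 0 ℚᵘ.+ mkℚᵘ b 0} (*≡* cross))
                    (fromℚᵘ-homo-+ (mkℚᵘ a 0) (mkℚᵘ b 0))
  where
  cross : (a ℤ.+ b) ℤ.* + 1 ≡ (a ℤ.* + 1 ℤ.+ b ℤ.* + 1) ℤ.* + 1
  cross = cong (ℤ._* + 1) (sym (cong₂ ℤ._+_ (ℤ.*-identityʳ a) (ℤ.*-identityʳ b)))

fromℤ-* : ∀ a b → fromℤ (a ℤ.* b) ≡ fromℤ a * fromℤ b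
fromℤ-* a b = fromℚᵘ-homo-* (mkℚᵘ a 0) (mkℚᵘ b 0)

fromℤ-neg : ∀ a → fromℤ (ℤ.- a) ≡ - fromℤ a
fromℤ-neg a = fromℚᵘ-homo‿- (mkℚᵘ a 0)

ι-+ : ∀ m n → ι (m ℕ.+ n) ≡ ι m + ι n
ι-+ m n = trans (cong fromℤ (ℤ.pos-+ m n)) (fromℤ-+ (+ m) (+ n))

ι-* : ∀ m n → ι (m ℕ.* n) ≡ ι m * ι n
ι-* m n = trans (cong fromℤ (ℤ.pos-* m n)) (fromℤ-* (+ m) (+ n))

ι-suc : ∀ m → ι (suc m) ≡ ι m + 1ℚ
ι-suc m = trans (cong ι (ℕ.+-comm 1 m)) (ι-+ m 1)

1/[1+_] : ℕ → ℚ
1/[1+ k ] = + 1 / suc k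

harmonic : ℕ → ℚ
harmonic m = sumBelow m 1/[1+_]

/-as-* : ∀ a k → + a / suc k ≡ ι a * 1/[1+ k ]
/-as-* a k = trans (fromℚᵘ-cong {mkℚᵘ (+ a) k} {mkℚᵘ (+ a) 0 ℚᵘ.* mkℚᵘ (+ 1) k} (*≡* cross))
                   (fromℚᵘ-homo-* (mkℚᵘ (+ a) 0) (mkℚᵘ (+ 1) k))
  where
  cross : + a ℤ.* + (1 ℕ.* suc k) ≡ (+ a ℤ.* + 1) ℤ.* + suc k
  cross = cong₂ ℤ._*_ (sym (ℤ.*-identityʳ (+ a))) (cong +_ (ℕ.*-identityˡ (suc k)))

1/-*-ι-inverse : ∀ m .{{_ : NonZero m}} → (+ 1 / m) * ι m ≡ 1ℚ
1/-*-ι-inverse (suc m) = trans (sym (fromℚᵘ-homo-* (mkℚᵘ (+ 1) m) (mkℚᵘ (+ suc m) 0)))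
                               (fromℚᵘ-cong {X} {mkℚᵘ (+ 1) 0} (*≡* cross))
  where
  X = mkℚᵘ (+ 1) m ℚᵘ.* mkℚᵘ (+ suc m) 0
  cross : ℚᵘ.↥ X ℤ.* + 1 ≡ + 1 ℤ.* ℚᵘ.↧ X
  cross = unitsCommute (+ suc m)
    where
    unitsCommute : ∀ x → (+ 1 ℤ.* x) ℤ.* + 1 ≡ + 1 ℤ.* (x ℤ.* + 1)
    unitsCommute = ℤ-Solver.solve-∀

ι-*-1/[1+]-inverse : ∀ k → ι (suc k) * 1/[1+ k ] ≡ 1ℚ
ι-*-1/[1+]-inverse k = trans (*-comm (ι (suc k)) 1/[1+ k ]) (1/-*-ι-inverse (suc k))

ι-*-fromℤ-*-1/[1+]-cancel : ∀ a b z n c → suc n ≡ b ℕ.* suc c →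
                            ι (a ℕ.* b) * fromℤ z * 1/[1+ n ] ≡ (+ a ℤ.* z) / suc c
ι-*-fromℤ-*-1/[1+]-cancel a b z n c 1+n≡b[1+c] = begin
  ι (a ℕ.* b) * fromℤ z * 1/[1+ n ]
    ≡⟨ cong (_* 1/[1+ n ]) (sym (fromℚᵘ-homo-* (mkℚᵘ (+ (a ℕ.* b)) 0) (mkℚᵘ z 0))) ⟩
  fromℚᵘ (mkℚᵘ (+ (a ℕ.* b)) 0 ℚᵘ.* mkℚᵘ z 0) * 1/[1+ n ]
    ≡⟨ sym (fromℚᵘ-homo-* (mkℚᵘ (+ (a ℕ.* b)) 0 ℚᵘ.* mkℚᵘ z 0) (mkℚᵘ (+ 1) n)) ⟩
  fromℚᵘ (mkℚᵘ (+ (a ℕ.* b)) 0 ℚᵘ.* mkℚᵘ z 0 ℚᵘ.* mkℚᵘ (+ 1) n)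
    ≡⟨ fromℚᵘ-cong {mkℚᵘ (+ (a ℕ.* b)) 0 ℚᵘ.* mkℚᵘ z 0 ℚᵘ.* mkℚᵘ (+ 1) n} {mkℚᵘ (+ a ℤ.* z) c}
                   (*≡* cross) ⟩
  (+ a ℤ.* z) / suc c ∎
  where
  cross : (+ (a ℕ.* b) ℤ.* z ℤ.* + 1) ℤ.* + suc c ≡ (+ a ℤ.* z) ℤ.* (+ 1 ℤ.* + 1 ℤ.* + suc n)
  cross = begin
    (+ (a ℕ.* b) ℤ.* z ℤ.* + 1) ℤ.* + suc c ≡⟨ cong (λ w → (w ℤ.* z ℤ.* + 1) ℤ.* + suc c) (ℤ.pos-* a b) ⟩
    (+ a ℤ.* + b ℤ.* z ℤ.* + 1) ℤ.* + suc c ≡⟨ regroup (+ a) (+ b) z (+ suc c) ⟩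
    (+ a ℤ.* z) ℤ.* (+ 1 ℤ.* + 1 ℤ.* (+ b ℤ.* + suc c))
      ≡⟨ cong (λ w → (+ a ℤ.* z) ℤ.* (+ 1 ℤ.* + 1 ℤ.* w)) (sym (trans (cong +_ 1+n≡b[1+c]) (ℤ.pos-* b (suc c)))) ⟩
    (+ a ℤ.* z) ℤ.* (+ 1 ℤ.* + 1 ℤ.* + suc n) ∎
    where
    regroup : ∀ a b z c → (a ℤ.* b ℤ.* z ℤ.* + 1) ℤ.* c ≡ (a ℤ.* z) ℤ.* (+ 1 ℤ.* + 1 ℤ.* (b ℤ.* c))
    regroup = ℤ-Solver.solve-∀

Integral : ℚ → Set
Integral q = ∃[ z ] q ≡ fromℤ z

integral-ι : ∀ m → Integral (ι m)
integral-ι m = + m , refl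

integral-+ : ∀ {x y} → Integral x → Integral y → Integral (x + y)
integral-+ (a , refl) (b , refl) = a ℤ.+ b , sym (fromℤ-+ a b)

integral-* : ∀ {x y} → Integral x → Integral y → Integral (x * y)
integral-* (a , refl) (b , refl) = a ℤ.* b , sym (fromℤ-* a b)

integral-neg : ∀ {x} → Integral x → Integral (- x)
integral-neg (a , refl) = ℤ.- a , sym (fromℤ-neg a)

integral-minus : ∀ {x y} → Integral x → Integral y → Integral (x - y)
integral-minus x y = integral-+ x (integral-neg y)

sumBelow-cong : ∀ m {f g : ℕ → ℚ} → (∀ k → k < m → f k ≡ g k) → sumBelow m f ≡ sumBelow m g
sumBelow-cong zero    f≗g = refl
sumBelow-cong (suc m) f≗g = cong₂ _+_ (sumBelow-cong m (λ k k<m → f≗g k (ℕ.m<n⇒m<1+n k<m))) (f≗g m (ℕ.n<1+n m))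

sumBelow-distribˡ : ∀ m c f → c * sumBelow m f ≡ sumBelow m (λ k → c * f k)
sumBelow-distribˡ zero    c f = *-zeroʳ c
sumBelow-distribˡ (suc m) c f = trans (*-distribˡ-+ c (sumBelow m f) (f m)) (cong (_+ c * f m) (sumBelow-distribˡ m c f))

sumBelow-telescope : ∀ m (g : ℕ → ℚ) → sumBelow m (λ k → g (suc k) - g k) ≡ g m - g 0
sumBelow-telescope zero    g = sym (+-inverseʳ (g 0))
sumBelow-telescope (suc m) g = trans (cong (_+ (g (suc m) - g m)) (sumBelow-telescope m g)) (chain (g 0) (g m) (g (suc m)))
  where
  chain : ∀ a b c → (b - a) + (c - b) ≡ c - a
  chain = solve 3 (λ a b c → (b :- a) :+ (c :- b) := c :- a) refl

-- Falling factorials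

falling-shift : ∀ y m → falling (y + 1ℚ) (suc m) ≡ (y + 1ℚ) * falling y m
falling-shift y zero = base y
  where
  base : ∀ y → 1ℚ * (y + 1ℚ - ι 0) ≡ (y + 1ℚ) * 1ℚ
  base = solve 1 (λ y → con 1ℚ :* (y :+ con 1ℚ :- con (ι 0)) := (y :+ con 1ℚ) :* con 1ℚ) refl
falling-shift y (suc m) = begin
  falling (y + 1ℚ) (suc m) * (y + 1ℚ - ι (suc m)) ≡⟨ cong₂ (λ u v → u * (y + 1ℚ - v)) (falling-shift y m) (ι-suc m) ⟩
  (y + 1ℚ) * falling y m * (y + 1ℚ - (ι m + 1ℚ))    ≡⟨ regroup y (falling y m) (ι m) ⟩
  (y + 1ℚ) * (falling y m * (y - ι m))               ∎
  where
  regroup : ∀ y f a → (y + 1ℚ) * f * (y + 1ℚ - (a + 1ℚ)) ≡ (y + 1ℚ) * (f * (y - a))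
  regroup = solve 3 (λ y f a → (y :+ con 1ℚ) :* f :* (y :+ con 1ℚ :- (a :+ con 1ℚ)) := (y :+ con 1ℚ) :* (f :* (y :- a))) refl

falling-Δ : ∀ y m → falling (y + 1ℚ) (suc m) - falling y (suc m) ≡ ι (suc m) * falling y m
falling-Δ y m = begin
  falling (y + 1ℚ) (suc m) - falling y m * (y - ι m) ≡⟨ cong (_- falling y m * (y - ι m)) (falling-shift y m) ⟩
  (y + 1ℚ) * falling y m - falling y m * (y - ι m)   ≡⟨ difference y (falling y m) (ι m) ⟩
  (ι m + 1ℚ) * falling y m                            ≡⟨ cong (_* falling y m) (sym (ι-suc m)) ⟩
  ι (suc m) * falling y m                             ∎
  where
  difference : ∀ y f a → (y + 1ℚ) * f - f * (y - a) ≡ (a + 1ℚ) * f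
  difference = solve 3 (λ y f a → (y :+ con 1ℚ) :* f :- f :* (y :- a) := (a :+ con 1ℚ) :* f) refl

sumBelow-falling : ∀ y m M →
                   ι (suc m) * sumBelow M (λ x → falling (y + ι x) m) ≡ falling (y + ι M) (suc m) - falling y (suc m)
sumBelow-falling y m M = begin
  ι (suc m) * sumBelow M (λ x → falling (y + ι x) m)  ≡⟨ sumBelow-distribˡ M (ι (suc m)) _ ⟩
  sumBelow M (λ x → ι (suc m) * falling (y + ι x) m)  ≡⟨ sumBelow-cong M (λ x _ → sym (step x)) ⟩
  sumBelow M (λ x → F (suc x) - F x)                  ≡⟨ sumBelow-telescope M F ⟩
  F M - F 0                                           ≡⟨ cong (λ u → F M - falling u (suc m)) (+-identityʳ y) ⟩
  falling (y + ι M) (suc m) - falling y (suc m)       ∎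
  where
  F : ℕ → ℚ
  F x = falling (y + ι x) (suc m)
  y+ι[1+x] : ∀ x → y + ι (suc x) ≡ (y + ι x) + 1ℚ
  y+ι[1+x] x = trans (cong (λ u → y + u) (ι-suc x)) (sym (+-assoc y (ι x) 1ℚ))
  step : ∀ x → F (suc x) - F x ≡ ι (suc m) * falling (y + ι x) m
  step x = trans (cong (λ u → falling u (suc m) - F x) (y+ι[1+x] x)) (falling-Δ (y + ι x) m)

fallingDivX≡falling : ∀ n x → fallingDivX n x ≡ falling (- 1ℚ + x) n
fallingDivX≡falling zero    x = refl
fallingDivX≡falling (suc n) x = begin
  fallingDivX n x * (x - ι (suc n))          ≡⟨ cong₂ (λ u v → u * (x - v)) (fallingDivX≡falling n x) (ι-suc n) ⟩
  falling (- 1ℚ + x) n * (x - (ι n + 1ℚ))    ≡⟨ cong (falling (- 1ℚ + x) n *_) (shift x (ι n)) ⟩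
  falling (- 1ℚ + x) n * (- 1ℚ + x - ι n)    ∎
  where
  shift : ∀ x a → x - (a + 1ℚ) ≡ - 1ℚ + x - a
  shift = solve 2 (λ x a → x :- (a :+ con 1ℚ) := :- con 1ℚ :+ x :- a) refl

-- fallingDeriv y m is the derivative of x ↦ falling x m at y (by the product rule).
fallingDeriv : ℚ → ℕ → ℚ
fallingDeriv y zero    = 0ℚ
fallingDeriv y (suc m) = fallingDeriv y m * (y - ι m) + falling y m

fallingTaylorRem : ℚ → ℚ → ℕ → ℚ
fallingTaylorRem y t zero    = 0ℚ
fallingTaylorRem y t (suc m) = fallingTaylorRem y t m * (y - ι m + t) + fallingDeriv y m

falling-+-expansion : ∀ y t m →
  falling (y + t) m ≡ falling y m + t * fallingDeriv y m + t * t * fallingTaylorRem y t m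
falling-+-expansion y t zero    = base t
  where
  base : ∀ t → 1ℚ ≡ 1ℚ + t * 0ℚ + t * t * 0ℚ
  base = solve 1 (λ t → con 1ℚ := con 1ℚ :+ t :* con 0ℚ :+ t :* t :* con 0ℚ) refl
falling-+-expansion y t (suc m) = begin
  falling (y + t) m * (y + t - ι m)
    ≡⟨ cong (_* (y + t - ι m)) (falling-+-expansion y t m) ⟩
  (falling y m + t * fallingDeriv y m + t * t * fallingTaylorRem y t m) * (y + t - ι m)
    ≡⟨ expand y t (ι m) (falling y m) (fallingDeriv y m) (fallingTaylorRem y t m) ⟩
  falling y m * (y - ι m) + t * (fallingDeriv y m * (y - ι m) + falling y m)
    + t * t * (fallingTaylorRem y t m * (y - ι m + t) + fallingDeriv y m) ∎
  where
  expand : ∀ y t a f d r → (f + t * d + t * t * r) * (y + t - a)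
                         ≡ f * (y - a) + t * (d * (y - a) + f) + t * t * (r * (y - a + t) + d)
  expand = solve 6 (λ y t a f d r → (f :+ t :* d :+ t :* t :* r) :* (y :+ t :- a)
                                   := f :* (y :- a) :+ t :* (d :* (y :- a) :+ f) :+ t :* t :* (r :* (y :- a :+ t) :+ d)) refl

integral-falling : ∀ {y} → Integral y → ∀ m → Integral (falling y m)
integral-falling y∈ℤ zero    = integral-ι 1
integral-falling y∈ℤ (suc m) = integral-* (integral-falling y∈ℤ m) (integral-minus y∈ℤ (integral-ι m))

integral-fallingDeriv : ∀ {y} → Integral y → ∀ m → Integral (fallingDeriv y m)
integral-fallingDeriv y∈ℤ zero    = integral-ι 0
integral-fallingDeriv y∈ℤ (suc m) =
  integral-+ (integral-* (integral-fallingDeriv y∈ℤ m) (integral-minus y∈ℤ (integral-ι m))) (integral-falling y∈ℤ m)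

integral-fallingTaylorRem : ∀ {y t} → Integral y → Integral t → ∀ m → Integral (fallingTaylorRem y t m)
integral-fallingTaylorRem y∈ℤ t∈ℤ zero    = integral-ι 0
integral-fallingTaylorRem y∈ℤ t∈ℤ (suc m) =
  integral-+ (integral-* (integral-fallingTaylorRem y∈ℤ t∈ℤ m) (integral-+ (integral-minus y∈ℤ (integral-ι m)) t∈ℤ))
             (integral-fallingDeriv y∈ℤ m)

-- The right-hand side and the derivative at −1

falling-ι-* : ∀ j k → falling (ι (j ℕ.+ k)) j * ι (k !) ≡ ι ((j ℕ.+ k) !)
falling-ι-* zero    k = *-identityˡ (ι (k !))
falling-ι-* (suc j) k = begin
  falling (ι (suc (j ℕ.+ k))) (suc j) * ι (k !) ≡⟨ cong (λ u → falling u (suc j) * ι (k !)) (ι-suc (j ℕ.+ k)) ⟩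
  falling (x + 1ℚ) (suc j) * ι (k !)            ≡⟨ cong (_* ι (k !)) (falling-shift x j) ⟩
  (x + 1ℚ) * falling x j * ι (k !)              ≡⟨ *-assoc (x + 1ℚ) (falling x j) (ι (k !)) ⟩
  (x + 1ℚ) * (falling x j * ι (k !))            ≡⟨ cong₂ _*_ (sym (ι-suc (j ℕ.+ k))) (falling-ι-* j k) ⟩
  ι (suc (j ℕ.+ k)) * ι ((j ℕ.+ k) !)           ≡⟨ sym (ι-* (suc (j ℕ.+ k)) ((j ℕ.+ k) !)) ⟩
  ι (suc (j ℕ.+ k) !)                           ∎
  where x = ι (j ℕ.+ k)

rhs7-term : ∀ n k → k ≤ n → falling (ι n) (n ℕ.∸ k) * (+ (k !) / suc k) ≡ ι (n !) * 1/[1+ k ]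
rhs7-term n k k≤n with ℕ.m≤n⇒∃[o]m+o≡n k≤n
... | j , refl = begin
  falling (ι (k ℕ.+ j)) (k ℕ.+ j ℕ.∸ k) * (+ (k !) / suc k)
    ≡⟨ cong₂ (λ u v → falling (ι u) v * (+ (k !) / suc k)) (ℕ.+-comm k j) (ℕ.m+n∸m≡n k j) ⟩
  falling (ι (j ℕ.+ k)) j * (+ (k !) / suc k)
    ≡⟨ cong (falling (ι (j ℕ.+ k)) j *_) (/-as-* (k !) k) ⟩
  falling (ι (j ℕ.+ k)) j * (ι (k !) * 1/[1+ k ])
    ≡⟨ sym (*-assoc (falling (ι (j ℕ.+ k)) j) (ι (k !)) 1/[1+ k ]) ⟩
  falling (ι (j ℕ.+ k)) j * ι (k !) * 1/[1+ k ]
    ≡⟨ cong (_* 1/[1+ k ]) (falling-ι-* j k) ⟩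
  ι ((j ℕ.+ k) !) * 1/[1+ k ]
    ≡⟨ cong (λ u → ι (u !) * 1/[1+ k ]) (ℕ.+-comm j k) ⟩
  ι ((k ℕ.+ j) !) * 1/[1+ k ] ∎

rhs7≡harmonic : ∀ n → rhs7 n ≡ signPow n * (ι (n !) * harmonic (suc n))
rhs7≡harmonic n = cong (signPow n *_) (begin
  sumBelow (suc n) (λ k → falling (ι n) (n ℕ.∸ k) * (+ (k !) / suc k))
    ≡⟨ sumBelow-cong (suc n) (λ k k<1+n → rhs7-term n k (ℕ.≤-pred k<1+n)) ⟩
  sumBelow (suc n) (λ k → ι (n !) * 1/[1+ k ])
    ≡⟨ sym (sumBelow-distribˡ (suc n) (ι (n !)) 1/[1+_]) ⟩
  ι (n !) * harmonic (suc n) ∎)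

falling-neg1 : ∀ m → falling (- 1ℚ) m ≡ signPow m * ι (m !)
falling-neg1 zero    = refl
falling-neg1 (suc m) = begin
  falling (- 1ℚ) m * (- 1ℚ - ι m)                ≡⟨ cong (_* (- 1ℚ - ι m)) (falling-neg1 m) ⟩
  signPow m * ι (m !) * (- 1ℚ - ι m)             ≡⟨ regroup (signPow m) (ι (m !)) (ι m) ⟩
  - signPow m * ((ι m + 1ℚ) * ι (m !))           ≡⟨ cong (λ u → - signPow m * (u * ι (m !))) (sym (ι-suc m)) ⟩
  - signPow m * (ι (suc m) * ι (m !))            ≡⟨ cong (- signPow m *_) (sym (ι-* (suc m) (m !))) ⟩
  - signPow m * ι (suc m !)                      ∎
  where
  regroup : ∀ s x a → s * x * (- 1ℚ - a) ≡ - s * ((a + 1ℚ) * x)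
  regroup = solve 3 (λ s x a → s :* x :* (:- con 1ℚ :- a) := :- s :* ((a :+ con 1ℚ) :* x)) refl

fallingDeriv-neg1 : ∀ n → fallingDeriv (- 1ℚ) (suc n) ≡ signPow n * ι (suc n !) * harmonic (suc n)
fallingDeriv-neg1 zero    = refl
fallingDeriv-neg1 (suc n) = begin
  fallingDeriv (- 1ℚ) (suc n) * (- 1ℚ - a) + falling (- 1ℚ) (suc n)
    ≡⟨ cong₂ (λ u v → u * (- 1ℚ - a) + v) (fallingDeriv-neg1 n) (falling-neg1 (suc n)) ⟩
  s * x * H * (- 1ℚ - a) + - s * x
    ≡⟨ regroup s x H a ⟩
  - s * ((a + 1ℚ) * x) * H + - s * x * 1ℚ
    ≡⟨ cong (λ u → - s * ((a + 1ℚ) * x) * H + - s * x * u) (sym [a+1]*h≡1) ⟩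
  - s * ((a + 1ℚ) * x) * H + - s * x * ((a + 1ℚ) * h)
    ≡⟨ factor s x H a h ⟩
  - s * ((a + 1ℚ) * x) * (H + h)
    ≡⟨ cong (λ u → - s * (u * x) * (H + h)) (sym (ι-suc (suc n))) ⟩
  - s * (ι (suc (suc n)) * x) * (H + h)
    ≡⟨ cong (λ u → - s * u * (H + h)) (sym (ι-* (suc (suc n)) (suc n !))) ⟩
  - s * ι (suc (suc n) !) * (H + h) ∎
  where
  s = signPow n
  x = ι (suc n !)
  H = harmonic (suc n)
  a = ι (suc n)
  h = 1/[1+ suc n ]
  [a+1]*h≡1 : (a + 1ℚ) * h ≡ 1ℚ
  [a+1]*h≡1 = trans (cong (_* h) (sym (ι-suc (suc n)))) (ι-*-1/[1+]-inverse (suc n))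
  regroup : ∀ s x H a → s * x * H * (- 1ℚ - a) + - s * x ≡ - s * ((a + 1ℚ) * x) * H + - s * x * 1ℚ
  regroup = solve 4 (λ s x H a → s :* x :* H :* (:- con 1ℚ :- a) :+ :- s :* x
                               := :- s :* ((a :+ con 1ℚ) :* x) :* H :+ :- s :* x :* con 1ℚ) refl
  factor : ∀ s x H a h → - s * ((a + 1ℚ) * x) * H + - s * x * ((a + 1ℚ) * h) ≡ - s * ((a + 1ℚ) * x) * (H + h)
  factor = solve 5 (λ s x H a h → :- s :* ((a :+ con 1ℚ) :* x) :* H :+ :- s :* x :* ((a :+ con 1ℚ) :* h)
                                := :- s :* ((a :+ con 1ℚ) :* x) :* (H :+ h)) refl

fallingDeriv-neg1≡ι*rhs7 : ∀ n → fallingDeriv (- 1ℚ) (suc n) ≡ ι (suc n) * rhs7 n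
fallingDeriv-neg1≡ι*rhs7 n = begin
  fallingDeriv (- 1ℚ) (suc n)                              ≡⟨ fallingDeriv-neg1 n ⟩
  signPow n * ι (suc n !) * harmonic (suc n)               ≡⟨ cong (λ u → signPow n * u * harmonic (suc n)) (ι-* (suc n) (n !)) ⟩
  signPow n * (ι (suc n) * ι (n !)) * harmonic (suc n)     ≡⟨ regroup (signPow n) (ι (suc n)) (ι (n !)) (harmonic (suc n)) ⟩
  ι (suc n) * (signPow n * (ι (n !) * harmonic (suc n)))   ≡⟨ cong (ι (suc n) *_) (sym (rhs7≡harmonic n)) ⟩
  ι (suc n) * rhs7 n                                       ∎
  where
  regroup : ∀ s a x H → s * (a * x) * H ≡ a * (s * (x * H))
  regroup = solve 4 (λ s a x H → s :* (a :* x) :* H := a :* (s :* (x :* H))) refl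

riemannSum-fallingDivX-error : ∀ n M .{{_ : NonZero M}} →
  + 1 / M * sumBelow M (λ x → fallingDivX n (ι x)) - rhs7 n ≡ ι M * fallingTaylorRem (- 1ℚ) (ι M) (suc n) * 1/[1+ n ]
riemannSum-fallingDivX-error n M =
  solveFor {ι (suc n)} {1/[1+ n ]} {+ 1 / M} {rhs7 n}
           (ι-*-1/[1+]-inverse n) (1/-*-ι-inverse M) scaledSum (fallingDeriv-neg1≡ι*rhs7 n)
  where
  S = sumBelow M (λ x → fallingDivX n (ι x))
  t = ι M
  D = fallingDeriv (- 1ℚ) (suc n)
  R = fallingTaylorRem (- 1ℚ) t (suc n)
  F = falling (- 1ℚ) (suc n)

  scaledSum : ι (suc n) * S ≡ t * D + t * t * R
  scaledSum = begin
    ι (suc n) * S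
      ≡⟨ cong (ι (suc n) *_) (sumBelow-cong M (λ x _ → fallingDivX≡falling n (ι x))) ⟩
    ι (suc n) * sumBelow M (λ x → falling (- 1ℚ + ι x) n)
      ≡⟨ sumBelow-falling (- 1ℚ) n M ⟩
    falling (- 1ℚ + t) (suc n) - F
      ≡⟨ cong (_- F) (falling-+-expansion (- 1ℚ) t (suc n)) ⟩
    F + t * D + t * t * R - F
      ≡⟨ cancel F (t * D) (t * t * R) ⟩
    t * D + t * t * R ∎
    where
    cancel : ∀ f a b → f + a + b - f ≡ a + b
    cancel = solve 3 (λ f a b → f :+ a :+ b :- f := a :+ b) refl

  solveFor : ∀ {c w u r} → c * w ≡ 1ℚ → u * t ≡ 1ℚ → c * S ≡ t * D + t * t * R → D ≡ c * r → u * S - r ≡ t * R * w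
  solveFor {c} {w} {u} {r} cw≡1 ut≡1 cS≡ D≡cr = begin
    u * S - r                           ≡⟨ *-identityʳ (u * S - r) ⟨
    (u * S - r) * 1ℚ                    ≡⟨ cong (λ v → (u * S - r) * v) cw≡1 ⟨
    (u * S - r) * (c * w)               ≡⟨ regroup₁ u S r c w ⟩
    (u * (c * S) - c * r) * w           ≡⟨ cong₂ (λ a b → (u * a - b) * w) cS≡ (sym D≡cr) ⟩
    (u * (t * D + t * t * R) - D) * w   ≡⟨ regroup₂ u t D R w ⟩
    ((u * t) * (D + t * R) - D) * w     ≡⟨ cong (λ v → (v * (D + t * R) - D) * w) ut≡1 ⟩
    (1ℚ * (D + t * R) - D) * w          ≡⟨ regroup₃ t D R w ⟩
    t * R * w                           ∎
    where
    regroup₁ : ∀ u S r c w → (u * S - r) * (c * w) ≡ (u * (c * S) - c * r) * w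
    regroup₁ = solve 5 (λ u S r c w → (u :* S :- r) :* (c :* w) := (u :* (c :* S) :- c :* r) :* w) refl
    regroup₂ : ∀ u t D R w → (u * (t * D + t * t * R) - D) * w ≡ ((u * t) * (D + t * R) - D) * w
    regroup₂ = solve 5 (λ u t D R w → (u :* (t :* D :+ t :* t :* R) :- D) :* w := ((u :* t) :* (D :+ t :* R) :- D) :* w) refl
    regroup₃ : ∀ t D R w → (1ℚ * (D + t * R) - D) * w ≡ t * R * w
    regroup₃ = solve 4 (λ t D R w → (con 1ℚ :* (D :+ t :* R) :- D) :* w := t :* R :* w) refl

-- p-adic valuations of rationals

^-monoʳ-∣ : ∀ m {k K} → k ≤ K → m ^ k ∣ m ^ K
^-monoʳ-∣ m {k} k≤K with ℕ.m≤n⇒∃[o]m+o≡n k≤K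
... | j , refl = subst (m ^ k ∣_) (sym (ℕ.^-distribˡ-+-* m k j)) (m∣m*n (m ^ j))

module _ {p : ℕ} (p-prime : Prime p) where

  private instance
    p≢0 : NonZero p
    p≢0 = prime⇒nonZero p-prime

  p^k∣m*n∧p∤n⇒p^k∣m : ∀ k {m n} → ¬ p ∣ n → p ^ k ∣ m ℕ.* n → p ^ k ∣ m
  p^k∣m*n∧p∤n⇒p^k∣m zero    {m} p∤n _ = 1∣ m
  p^k∣m*n∧p∤n⇒p^k∣m (suc k) {m} {n} p∤n p^[1+k]∣mn with euclidsLemma m n p-prime (∣-trans (m∣m*n (p ^ k)) p^[1+k]∣mn)
  ... | inj₂ p∣n = contradiction p∣n p∤n
  ... | inj₁ (divides q refl) = subst (p ^ suc k ∣_) (ℕ.*-comm p q) (*-monoʳ-∣ p p^k∣q)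
    where
    p^k∣q : p ^ k ∣ q
    p^k∣q = p^k∣m*n∧p∤n⇒p^k∣m k p∤n
              (*-cancelˡ-∣ p (subst (p ^ suc k ∣_) (ℕ-regroup q p n) p^[1+k]∣mn))
      where
      ℕ-regroup : ∀ q p n → q ℕ.* p ℕ.* n ≡ p ℕ.* (q ℕ.* n)
      ℕ-regroup = ℕ-Solver.solve-∀

  pAdicValGE-/ : ∀ k a c .{{_ : NonZero c}} → ¬ p ∣ c → p ^ k ∣ ℤ.∣ a ∣ → pAdicValGE p (a / c) k
  pAdicValGE-/ k a c p∤c p^k∣a = p^k∣num , p∤den
    where
    g = ℤ.∣ gcd a (+ c) ∣
    num*g≡a : ℤ.∣ ↥ (a / c) ∣ ℕ.* g ≡ ℤ.∣ a ∣
    num*g≡a = trans (sym (ℤ.abs-* (↥ (a / c)) (gcd a (+ c)))) (cong ℤ.∣_∣ (↥-/ a c))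
    den*g≡c : ↧ₙ (a / c) ℕ.* g ≡ c
    den*g≡c = trans (sym (ℤ.abs-* (↧ (a / c)) (gcd a (+ c)))) (cong ℤ.∣_∣ (↧-/ a c))
    p∤g : ¬ p ∣ g
    p∤g p∣g = p∤c (∣-trans p∣g (divides (↧ₙ (a / c)) (sym den*g≡c)))
    p∤den : ¬ p ∣ ↧ₙ (a / c)
    p∤den p∣den = p∤c (subst (p ∣_) den*g≡c (∣-trans p∣den (m∣m*n g)))
    p^k∣num : p ^ k ∣ ℤ.∣ ↥ (a / c) ∣
    p^k∣num = p^k∣m*n∧p∤n⇒p^k∣m k p∤g (subst (p ^ k ∣_) (sym num*g≡a) p^k∣a)

  cofactor< : ∀ {d} q → suc d ≡ suc q ℕ.* p → q < d
  cofactor< {d} q 1+d≡[1+q]p = ℕ.≤-pred (subst (suc q <_) (sym 1+d≡[1+q]p)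
    (ℕ.m<m*n (suc q) p (ℕ.nonTrivial⇒n>1 p {{prime⇒nonTrivial p-prime}})))

  PrimePowerSplitting : ℕ → Set
  PrimePowerSplitting d = Σ[ e ∈ ℕ ] Σ[ c ∈ ℕ ] suc d ≡ p ^ e ℕ.* suc c × ¬ p ∣ suc c × e ≤ d

  prime-power-split : ∀ d → PrimePowerSplitting d
  prime-power-split = <-rec PrimePowerSplitting split
    where
    split : ∀ d → (∀ {d′} → d′ < d → PrimePowerSplitting d′) → PrimePowerSplitting d
    split d rec with p ∣? suc d
    ... | no p∤1+d = 0 , d , sym (ℕ.+-identityʳ (suc d)) , p∤1+d , z≤n
    ... | yes (divides (suc q) 1+d≡[1+q]p) with rec (cofactor< q 1+d≡[1+q]p)
    ... | e , c , 1+q≡p^e[1+c] , p∤1+c , e≤q =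
      suc e , c , trans 1+d≡[1+q]p (trans (cong (ℕ._* p) 1+q≡p^e[1+c]) (ℕ-regroup (p ^ e) (suc c) p))
            , p∤1+c , ℕ.≤-trans (s≤s e≤q) (cofactor< q 1+d≡[1+q]p)
      where
      ℕ-regroup : ∀ x c p → x ℕ.* c ℕ.* p ≡ p ℕ.* x ℕ.* c
      ℕ-regroup = ℕ-Solver.solve-∀

  pAdicValGE-p^N*z/[1+m] : ∀ k m N z → k ℕ.+ m ≤ N → pAdicValGE p (ι (p ^ N) * fromℤ z * 1/[1+ m ]) k
  pAdicValGE-p^N*z/[1+m] k m N z k+m≤N with prime-power-split m
  ... | e , c , 1+m≡p^e[1+c] , p∤1+c , e≤m =
    subst (λ q → pAdicValGE p q k) (sym as-fraction) (pAdicValGE-/ k (+ p ^ (N ℕ.∸ e) ℤ.* z) (suc c) p∤1+c p^k∣numerator)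
    where
    e≤N : e ≤ N
    e≤N = ℕ.≤-trans e≤m (ℕ.m+n≤o⇒n≤o k k+m≤N)
    as-fraction : ι (p ^ N) * fromℤ z * 1/[1+ m ] ≡ (+ p ^ (N ℕ.∸ e) ℤ.* z) / suc c
    as-fraction = trans
      (cong (λ u → ι u * fromℤ z * 1/[1+ m ])
            (trans (cong (p ^_) (sym (ℕ.m∸n+n≡m e≤N))) (ℕ.^-distribˡ-+-* p (N ℕ.∸ e) e)))
      (ι-*-fromℤ-*-1/[1+]-cancel (p ^ (N ℕ.∸ e)) (p ^ e) z m c 1+m≡p^e[1+c])
    p^k∣numerator : p ^ k ∣ ℤ.∣ + p ^ (N ℕ.∸ e) ℤ.* z ∣
    p^k∣numerator = subst (p ^ k ∣_) (sym (ℤ.abs-* (+ p ^ (N ℕ.∸ e)) z))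
      (∣-trans (^-monoʳ-∣ p (ℕ.m+n≤o⇒m≤o∸n k (ℕ.≤-trans (ℕ.+-monoʳ-≤ k e≤m) k+m≤N))) (m∣m*n ℤ.∣ z ∣))

mainTheorem7 : (p : ℕ) → (pp : Prime p) → (n : ℕ) →
    VolkenbornIntegralIs p pp (fallingDivX n) (rhs7 n)
mainTheorem7 p pp n k = k ℕ.+ n , λ N k+n≤N →
  let instance _ = ℕ.m^n≢0 p N {{prime⇒nonZero pp}}
      z , R≡z = integral-fallingTaylorRem (integral-neg (integral-ι 1)) (integral-ι (p ^ N)) (suc n)
  in subst (λ q → pAdicValGE p q k)
           (sym (trans (riemannSum-fallingDivX-error n (p ^ N)) (cong (λ R → ι (p ^ N) * R * 1/[1+ n ]) R≡z)))
           (pAdicValGE-p^N*z/[1+m] pp k n N z k+n≤N)
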